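{- For every $\alpha\in Fm''$: if $\models_{\cal TML}\alpha$, then $\vdash_{\mathbb T}\alpha$.
   Context: $M_4=\{\mathbf 0,\mathbf n,\mathbf b,\mathbf 1\}$ with $\neg\mathbf 0=\mathbf 1$, $\neg\mathbf 1=\mathbf 0$, $\neg\mathbf n=\mathbf n$, $\neg\mathbf b=\mathbf b$ and $\succ$: $\mathbf 0\succ y=\mathbf 1$; $\mathbf n\succ\mathbf 0=\mathbf n$, $\mathbf n\succ\mathbf n=\mathbf 1$, $\mathbf n\succ\mathbf b=\mathbf b$, $\mathbf n\succ\mathbf 1=\mathbf 1$; $\mathbf b\succ\mathbf 0=\mathbf b$, $\mathbf b\succ\mathbf n=\mathbf n$, $\mathbf b\succ\mathbf b=\mathbf 1$, $\mathbf b\succ\mathbf 1=\mathbf 1$; $\mathbf 1\succ y=y$. Formulas of $Fm''$ are built from propositional variables with $\neg$, $\succ$; a valuation is a homomorphism $h:Fm''\to M_4$; $\models_{\cal TML}\alpha$ means $h(\alpha)=\mathbf 1$ for every valuation $h$. Signed formulas are $T(\alpha)$, $F(\alpha)$. Rules of $\mathbb T$ (premise $\Rightarrow$ conclusion sets separated by $|$): $T(\alpha\succ\beta)\Rightarrow \{T(\beta)\}\,|\,\{T(\neg\alpha),F(\beta),T(\neg\beta)\}\,|\,\{F(\alpha),F(\beta),F(\neg\beta)\}$; $F(\alpha\succ\beta)\Rightarrow\{T(\alpha),F(\beta),F(\neg\beta)\}\,|\,\{F(\neg\alpha),F(\beta),T(\neg\beta)\}$; $T(\neg(\alpha\succ\beta))\Rightarrow\{T(\alpha),F(\beta),T(\neg\beta)\}\,|\,\{F(\neg\alpha),T(\beta),T(\neg\beta)\}$;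 $F(\neg(\alpha\succ\beta))\Rightarrow\{F(\neg\beta)\}\,|\,\{T(\neg\alpha),T(\beta),T(\neg\beta)\}\,|\,\{F(\alpha),F(\beta),T(\neg\beta)\}$; $T(\neg\neg\alpha)\Rightarrow\{T(\alpha)\}$; $F(\neg\neg\alpha)\Rightarrow\{F(\alpha)\}$. A tableau for $\eta$ is a finite tree with root $\eta$ built by repeatedly choosing a non-closed branch and a signed formula on it that is a rule premise, and extending the branch by one sub-branch per conclusion set. A branch is closed if it contains $T(\gamma)$ and $F(\gamma)$ for some $\gamma$; a tableau is closed if all branches are closed. $\vdash_{\mathbb T}\alpha$ means there exists a closed tableau for $F(\alpha)$. -}

module Defs where

open import Data.Nat using (ℕ)
open import Data.List using (List; []; _∷_; _++_)
open import Data.List.Membership.Propositional using (_∈_)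
open import Data.List.Relation.Unary.All using (All)
open import Data.Product using (∃; _×_)
open import Relation.Nullary using (¬_)
open import Relation.Binary.PropositionalEquality using (_≡_)

infixr 5 _≻_
data Fm : Set where
  var : ℕ → Fm
  ¬'  : Fm → Fm
  _≻_ : Fm → Fm → Fm

data M4 : Set where
  𝟎 𝐧 𝐛 𝟏 : M4

neg : M4 → M4
neg 𝟎 = 𝟏
neg 𝟏 = 𝟎
neg 𝐧 = 𝐧
neg 𝐛 = 𝐛

imp : M4 → M4 → M4
imp 𝟎 y = 𝟏
imp 𝐧 𝟎 = 𝐧
imp 𝐧 𝐧 = 𝟏
imp 𝐧 𝐛 = 𝐛
imp 𝐧 𝟏 = 𝟏
imp 𝐛 𝟎 = 𝐛
imp 𝐛 𝐧 = 𝐧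
imp 𝐛 𝐛 = 𝟏
imp 𝐛 𝟏 = 𝟏
imp 𝟏 y = y

eval : (ℕ → M4) → Fm → M4
eval v (var p) = v p
eval v (¬' a)  = neg (eval v a)
eval v (a ≻ b) = imp (eval v a) (eval v b)

⊨TML : Fm → Set
⊨TML α = ∀ (v : ℕ → M4) → eval v α ≡ 𝟏

data SFm : Set where
  T F : Fm → SFm

-- Rules of 𝕋: Rule η Ss means η is a premise with list of conclusion sets Ss
data Rule : SFm → List (List SFm) → Set where
  T≻  : ∀ a b → Rule (T (a ≻ b))
          ((T b ∷ []) ∷ (T (¬' a) ∷ F b ∷ T (¬' b) ∷ []) ∷ (F a ∷ F b ∷ F (¬' b) ∷ []) ∷ [])
  F≻  : ∀ a b → Rule (F (a ≻ b))
          ((T a ∷ F b ∷ F (¬' b) ∷ []) ∷ (F (¬' a) ∷ F b ∷ T (¬' b) ∷ []) ∷ [])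
  T¬≻ : ∀ a b → Rule (T (¬' (a ≻ b)))
          ((T a ∷ F b ∷ T (¬' b) ∷ []) ∷ (F (¬' a) ∷ T b ∷ T (¬' b) ∷ []) ∷ [])
  F¬≻ : ∀ a b → Rule (F (¬' (a ≻ b)))
          ((F (¬' b) ∷ []) ∷ (T (¬' a) ∷ T b ∷ T (¬' b) ∷ []) ∷ (F a ∷ F b ∷ T (¬' b) ∷ []) ∷ [])
  T¬¬ : ∀ a → Rule (T (¬' (¬' a))) ((T a ∷ []) ∷ [])
  F¬¬ : ∀ a → Rule (F (¬' (¬' a))) ((F a ∷ []) ∷ [])

Closed : List SFm → Set
Closed B = ∃ λ γ → (T γ ∈ B) × (F γ ∈ B)

-- ClosedTableauFrom B: there is a finite tableau extending the branch B
-- all of whose branches are closed.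
data ClosedTableauFrom : List SFm → Set where
  close  : ∀ {B} → Closed B → ClosedTableauFrom B
  expand : ∀ {B η Ss} → ¬ Closed B → η ∈ B → Rule η Ss →
           All (λ S → ClosedTableauFrom (S ++ B)) Ss → ClosedTableauFrom B

⊢𝕋 : Fm → Set
⊢𝕋 α = ClosedTableauFrom (F α ∷ [])

-- Every rule of 𝕋 is invertible for the designated values {𝐛, 𝟏}: a signed
-- formula holds under a valuation iff some conclusion set holds entirely.
-- Treating α and ¬α as one size, the conclusions of a rule only mention
-- immediate subformulas of its premise, so F(α) can be decomposed
-- exhaustively.  Either every branch closes, or an open branch remains
-- whose literals determine a valuation (p gets the value whose designation
-- and that of its negation are prescribed by T(p) and T(¬p) being on the
-- branch); by invertibility it satisfies F(α), so α is not valid.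
module Submission where

open import Defs
open import Data.Bool using (Bool; true; false; not) renaming (T to IsTrue)
import Data.Bool.Properties as Bool
open import Data.Bool.ListAction using (any; all)
open import Data.Empty using (⊥; ⊥-elim)
open import Data.List using (List; []; _∷_; _++_)
open import Data.List.Membership.Propositional using (_∈_; find; lose)
open import Data.List.Membership.Propositional.Properties using (∈-++⁺ˡ; ∈-++⁺ʳ)
open import Data.List.Relation.Unary.All as All using (All; []; _∷_; all?)
open import Data.List.Relation.Unary.All.Properties using (++⁺; ++⁻ˡ; ++⁻ʳ; all⁻)
open import Data.List.Relation.Unary.Any as Any using (Any; here; there; any?)
open import Data.List.Relation.Unary.Any.Properties using (any⁺)
open import Data.Nat using (ℕ)
import Data.Nat.Properties as ℕ
open import Data.Product using (Σ; _×_; _,_)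
open import Data.Sum as Sum using (_⊎_; inj₁; inj₂)
open import Function using (_∘_)
open import Relation.Binary.Definitions using (DecidableEquality)
open import Relation.Binary.PropositionalEquality using (_≡_; refl; cong; cong₂; subst; sym)
open import Relation.Nullary using (¬_; Dec; yes; no)
open import Relation.Nullary.Decidable
  using (True; isYes; map′; _×-dec_; toWitness; fromWitness; fromWitnessFalse)

designated : M4 → Bool
designated 𝐛 = true
designated 𝟏 = true
designated _ = false

holds : (ℕ → M4) → SFm → Bool
holds v (T α) = designated (eval v α)
holds v (F α) = not (designated (eval v α))

_⊨_ : (ℕ → M4) → SFm → Set
v ⊨ η = IsTrue (holds v η)

values : List M4
values = 𝟎 ∷ 𝐧 ∷ 𝐛 ∷ 𝟏 ∷ []

∈-values : ∀ x → x ∈ values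
∈-values 𝟎 = here refl
∈-values 𝐧 = there (here refl)
∈-values 𝐛 = there (there (here refl))
∈-values 𝟏 = there (there (there (here refl)))

⟨_,_⟩ : M4 → M4 → ℕ → M4
⟨ x , y ⟩ 1 = y
⟨ x , y ⟩ _ = x

holds-premise-schema : ∀ {η Ss} → Rule η Ss →
  {_ : True (all? (λ x → all? (λ y →
          holds ⟨ x , y ⟩ η Bool.≟ any (all (holds ⟨ x , y ⟩)) Ss) values) values)} →
  ∀ x y → holds ⟨ x , y ⟩ η ≡ any (all (holds ⟨ x , y ⟩)) Ss
holds-premise-schema _ {ok} x y = All.lookup (All.lookup (toWitness ok) (∈-values x)) (∈-values y)

-- Both sides depend on v only through the values of the immediate
-- subformulas, so each instance is definitionally its two-variable schema
-- under ⟨ eval v a , eval v b ⟩.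
holds-premise : ∀ {η Ss} → Rule η Ss → ∀ v → holds v η ≡ any (all (holds v)) Ss
holds-premise (T≻ a b)  v = holds-premise-schema (T≻ (var 0) (var 1)) (eval v a) (eval v b)
holds-premise (F≻ a b)  v = holds-premise-schema (F≻ (var 0) (var 1)) (eval v a) (eval v b)
holds-premise (T¬≻ a b) v = holds-premise-schema (T¬≻ (var 0) (var 1)) (eval v a) (eval v b)
holds-premise (F¬≻ a b) v = holds-premise-schema (F¬≻ (var 0) (var 1)) (eval v a) (eval v b)
holds-premise (T¬¬ a)   v = holds-premise-schema (T¬¬ (var 0)) (eval v a) 𝟎
holds-premise (F¬¬ a)   v = holds-premise-schema (F¬¬ (var 0)) (eval v a) 𝟎

premise-holds : ∀ {η Ss} → Rule η Ss → ∀ v → Any (All (v ⊨_)) Ss → v ⊨ η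
premise-holds rule v some-holds =
  subst IsTrue (sym (holds-premise rule v)) (any⁺ _ (Any.map (all⁻ _) some-holds))

_≟ᶠ_ : DecidableEquality Fm
var p   ≟ᶠ var q   = map′ (cong var) (λ { refl → refl }) (p ℕ.≟ q)
¬' α    ≟ᶠ ¬' β    = map′ (cong ¬') (λ { refl → refl }) (α ≟ᶠ β)
(a ≻ b) ≟ᶠ (c ≻ d) = map′ (λ (a≡c , b≡d) → cong₂ _≻_ a≡c b≡d) (λ { refl → refl , refl })
                           (a ≟ᶠ c ×-dec b ≟ᶠ d)
var _   ≟ᶠ ¬' _    = no λ ()
var _   ≟ᶠ (_ ≻ _) = no λ ()
¬' _    ≟ᶠ var _   = no λ ()
¬' _    ≟ᶠ (_ ≻ _) = no λ ()
(_ ≻ _) ≟ᶠ var _   = no λ ()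
(_ ≻ _) ≟ᶠ ¬' _    = no λ ()

_≟ˢ_ : DecidableEquality SFm
T α ≟ˢ T β = map′ (cong T) (λ { refl → refl }) (α ≟ᶠ β)
F α ≟ˢ F β = map′ (cong F) (λ { refl → refl }) (α ≟ᶠ β)
T _ ≟ˢ F _ = no λ ()
F _ ≟ˢ T _ = no λ ()

open import Data.List.Membership.DecPropositional _≟ˢ_ using (_∈?_)

ClashesWith : List SFm → SFm → Set
ClashesWith B (T γ) = F γ ∈ B
ClashesWith B (F γ) = ⊥

clashesWith? : ∀ B η → Dec (ClashesWith B η)
clashesWith? B (T γ) = F γ ∈? B
clashesWith? B (F γ) = no λ ()

closed-by-clash : ∀ {B} → Any (ClashesWith B) B → Closed B
closed-by-clash clash with find clash
... | T γ , Tγ∈B , Fγ∈B = γ , Tγ∈B , Fγ∈B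

closed? : ∀ B → Dec (Closed B)
closed? B = map′ closed-by-clash (λ (_ , Tγ∈B , Fγ∈B) → lose Tγ∈B Fγ∈B) (any? (clashesWith? B) B)

data Literal : SFm → Set where
  T-var  : ∀ p → Literal (T (var p))
  F-var  : ∀ p → Literal (F (var p))
  T¬-var : ∀ p → Literal (T (¬' (var p)))
  F¬-var : ∀ p → Literal (F (¬' (var p)))

LiteralsHold : (ℕ → M4) → List SFm → Set
LiteralsHold v B = ∀ {η} → Literal η → η ∈ B → v ⊨ η

withDesignation : Bool → Bool → M4
withDesignation true  true  = 𝐛
withDesignation true  false = 𝟏
withDesignation false true  = 𝟎
withDesignation false false = 𝐧

designated-withDesignation : ∀ d e → designated (withDesignation d e) ≡ d
designated-withDesignation true  true  = refl
designated-withDesignation true  false = refl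
designated-withDesignation false true  = refl
designated-withDesignation false false = refl

designated-neg-withDesignation : ∀ d e → designated (neg (withDesignation d e)) ≡ e
designated-neg-withDesignation true  true  = refl
designated-neg-withDesignation true  false = refl
designated-neg-withDesignation false true  = refl
designated-neg-withDesignation false false = refl

branchValuation : List SFm → ℕ → M4
branchValuation B p = withDesignation (isYes (T (var p) ∈? B)) (isYes (T (¬' (var p)) ∈? B))

branchValuation-literals : ∀ {B} → ¬ Closed B → LiteralsHold (branchValuation B) B
branchValuation-literals _ (T-var p) Tp∈B =
  subst IsTrue (sym (designated-withDesignation _ _)) (fromWitness Tp∈B)
branchValuation-literals ¬closed (F-var p) Fp∈B =
  subst (IsTrue ∘ not) (sym (designated-withDesignation _ _))
        (fromWitnessFalse λ Tp∈B → ¬closed (var p , Tp∈B , Fp∈B))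
branchValuation-literals _ (T¬-var p) T¬p∈B =
  subst IsTrue (sym (designated-neg-withDesignation _ _)) (fromWitness T¬p∈B)
branchValuation-literals ¬closed (F¬-var p) F¬p∈B =
  subst (IsTrue ∘ not) (sym (designated-neg-withDesignation _ _))
        (fromWitnessFalse λ T¬p∈B → ¬closed (¬' (var p) , T¬p∈B , F¬p∈B))

Model : List SFm → List SFm → Set
Model B Γ = Σ (ℕ → M4) λ v → All (v ⊨_) Γ × LiteralsHold v B

Verdict : List SFm → List SFm → Set
Verdict B Γ = ClosedTableauFrom B ⊎ Model B Γ

-- Γ lists the formulas of the branch still to be decomposed.  Passing the
-- analysis of the remaining ones as an argument lets each analyser recurse
-- only on immediate subformulas, which makes the construction structural.
Analysis : List SFm → Set
Analysis Γ = ∀ B → All (_∈ B) Γ → Verdict B Γ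

Analyser : SFm → Set
Analyser η = ∀ {Γ} → Analysis Γ → Analysis (η ∷ Γ)

analysis-[] : Analysis []
analysis-[] B _ with closed? B
... | yes closed = inj₁ (close closed)
... | no ¬closed    = inj₂ (branchValuation B , [] , branchValuation-literals ¬closed)

analyse-literal : ∀ {η} → Literal η → Analyser η
analyse-literal lit analyse-Γ B (η∈B ∷ Γ⊆B) =
  Sum.map₂ (λ (v , Γ-holds , lits) → v , lits lit η∈B ∷ Γ-holds , lits) (analyse-Γ B Γ⊆B)

analyse-all : ∀ {S Γ} → All Analyser S → Analysis Γ → Analysis (S ++ Γ)
analyse-all []                     analyse-Γ = analyse-Γ
analyse-all (analyser ∷ analysers) analyse-Γ = analyser (analyse-all analysers analyse-Γ)

all-or-any : ∀ {A : Set} {P Q : A → Set} {xs} → All (λ x → P x ⊎ Q x) xs → All P xs ⊎ Any Q xs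
all-or-any []           = inj₁ []
all-or-any (inj₂ q ∷ _) = inj₂ (here q)
all-or-any (inj₁ p ∷ rest) = Sum.map (p ∷_) there (all-or-any rest)

extend-branch : ∀ (S : List SFm) {B Γ} → All (_∈ B) Γ → All (_∈ S ++ B) (S ++ Γ)
extend-branch S Γ⊆B = ++⁺ (All.tabulate ∈-++⁺ˡ) (All.map (∈-++⁺ʳ S) Γ⊆B)

premise-model : ∀ {η Ss B Γ} → Rule η Ss →
  Any (λ S → Model (S ++ B) (S ++ Γ)) Ss → Model B (η ∷ Γ)
premise-model rule some-model with find some-model
... | S , S∈Ss , v , S++Γ-holds , lits =
  v , premise-holds rule v (lose S∈Ss (++⁻ˡ S S++Γ-holds)) ∷ ++⁻ʳ S S++Γ-holds ,
  λ lit η∈B → lits lit (∈-++⁺ʳ S η∈B)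

analyse-rule : ∀ {η Ss} → Rule η Ss → All (All Analyser) Ss → Analyser η
analyse-rule rule analysers analyse-Γ B (η∈B ∷ Γ⊆B) with closed? B
... | yes closed = inj₁ (close closed)
... | no ¬closed = Sum.map (expand ¬closed η∈B rule) (premise-model rule) (all-or-any
        (All.map (λ {S} analysers-S → analyse-all analysers-S analyse-Γ (S ++ B) (extend-branch S Γ⊆B)) analysers))

analyseT  : ∀ α → Analyser (T α)
analyseF  : ∀ α → Analyser (F α)
analyseT¬ : ∀ α → Analyser (T (¬' α))
analyseF¬ : ∀ α → Analyser (F (¬' α))

analyseT (var p) = analyse-literal (T-var p)
analyseT (¬' α)  = analyseT¬ α
analyseT (a ≻ b) = analyse-rule (T≻ a b)
  ( (analyseT b ∷ [])
  ∷ (analyseT¬ a ∷ analyseF b ∷ analyseT¬ b ∷ [])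
  ∷ (analyseF a ∷ analyseF b ∷ analyseF¬ b ∷ [])
  ∷ [])

analyseF (var p) = analyse-literal (F-var p)
analyseF (¬' α)  = analyseF¬ α
analyseF (a ≻ b) = analyse-rule (F≻ a b)
  ( (analyseT a ∷ analyseF b ∷ analyseF¬ b ∷ [])
  ∷ (analyseF¬ a ∷ analyseF b ∷ analyseT¬ b ∷ [])
  ∷ [])

analyseT¬ (var p) = analyse-literal (T¬-var p)
analyseT¬ (¬' α)  = analyse-rule (T¬¬ α) ((analyseT α ∷ []) ∷ [])
analyseT¬ (a ≻ b) = analyse-rule (T¬≻ a b)
  ( (analyseT a ∷ analyseF b ∷ analyseT¬ b ∷ [])
  ∷ (analyseF¬ a ∷ analyseT b ∷ analyseT¬ b ∷ [])
  ∷ [])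

analyseF¬ (var p) = analyse-literal (F¬-var p)
analyseF¬ (¬' α)  = analyse-rule (F¬¬ α) ((analyseF α ∷ []) ∷ [])
analyseF¬ (a ≻ b) = analyse-rule (F¬≻ a b)
  ( (analyseF¬ b ∷ [])
  ∷ (analyseT¬ a ∷ analyseT b ∷ analyseT¬ b ∷ [])
  ∷ (analyseF a ∷ analyseF b ∷ analyseT¬ b ∷ [])
  ∷ [])

theorem5p8 : (α : Fm) → ⊨TML α → ⊢𝕋 α
theorem5p8 α valid with analyseF α analysis-[] (F α ∷ []) (here refl ∷ [])
... | inj₁ tableau = tableau
... | inj₂ (v , Fα-holds ∷ [] , _) =
  ⊥-elim (subst (IsTrue ∘ not ∘ designated) (valid v) Fα-holds)
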